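{- Let $I=(G,D,\mathsf{rev},C)$ be an instance of Max Weight Nullary 2CSP, let $Y\subseteq V(G)$, and let $I\{Y\}$ be the compressed instance. Then the optimum solutions of $I$ and $I\{Y\}$ have equal revenues.
   Context: An instance $I=(G,D,\mathsf{rev},C)$ of Max Weight Nullary 2CSP consists of a simple graph $G$; for each vertex $u$ a finite domain $D_u$ containing a special value $0$ and a revenue function $\mathsf{rev}_u:D_u\to\mathbb{R}_{\ge0}$ with $\mathsf{rev}_u(0)=0$; for each edge $uv$ a constraint $C_{uv}\subseteq D_u\times D_v$ containing $\{0\}\times D_v$ and $D_u\times\{0\}$. A solution is $\phi$ with $\phi(u)\in D_u$ and $(\phi(u),\phi(v))\in C_{uv}$ for all edges; for $R\subseteq V(G)$, $\mathsf{rev}(\phi|_R)=\sum_{u\in R}\mathsf{rev}_u(\phi(u))$, and the revenue of $\phi$ is $\mathsf{rev}(\phi|_{V(G)})$. For $Z\subseteq V(G)$, $I[Z]$ is the instance obtained by deleting all vertices outside $Z$ and all constraints incident to them. $N(C)$ is the set of vertices outside $C$ adjacent to $C$. The compressed graph $G\{Y\}$ has vertex set $Y\cup\{N(C): C \text{ a connected component of } G\setminus Y\}$ (each such neighborhood a new vertex) and edges $E(G[Y])\cup\{vS: S\in V(G\{Y\})\setminus Y,\ v\in S\}$. The compressed instance $I\{Y\}=(G\{Y\},D',\mathsf{rev}',C')$: for $v\in Y$, $D'_v=D_v$, $\mathsf{rev}'_v=\mathsf{rev}_v$; for $u,v\in Y$, $C'_{uv}=C_{uv}$. For $S=\{u_1,\dots,u_s\}\in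 V(G\{Y\})\setminus Y$, let $R$ be the union of all connected components of $G\setminus Y$ with neighborhood $S$, and $I_S=I[R\cup S]$; then $D'_S=\{0\}\cup\prod_{v\in S}D_v$, $\mathsf{rev}'_S(0)=0$, and $\mathsf{rev}'_S(d_1,\dots,d_s)$ is the maximum of $\mathsf{rev}(\phi|_R)$ over solutions $\phi$ of $I_S$ with $\phi(u_i)=d_i$ for all $i$ (or $0$ if none exists); for $u\in S$, $C'_{uS}=\{(d,e)\in D'_u\times D'_S: d=0\text{ or }e=0\text{ or }e(u)=d\}$. -}

module Defs where

open import Data.Nat using (ℕ; zero; suc)
open import Data.Fin using (Fin)
open import Data.Fin.Subset using (Subset; _∈_; _∉_; inside; outside)
open import Data.Fin.Subset.Properties using (_∈?_)
open import Data.Bool using (Bool; true; false; T; not; _∧_; _∨_; if_then_else_)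
open import Data.List using (List; []; _∷_; _++_; map; foldr; mapMaybe)
import Data.List as List
import Data.Bool.ListAction as BLA
open import Data.Vec using (Vec; []; _∷_; lookup; tabulate)
open import Data.Vec.Properties using (≡-dec)
import Data.Bool.Properties as BoolP
open import Data.Maybe using (Maybe; just; nothing)
open import Data.Product using (Σ; Σ-syntax; ∃; _×_; _,_; proj₁; proj₂)
open import Data.Sum using (_⊎_; inj₁; inj₂)
open import Data.Unit using (⊤)
open import Data.Empty using (⊥)
open import Relation.Nullary using (Dec; yes; no; ¬_; does)
open import Relation.Nullary.Decidable using (T?)
open import Relation.Binary.PropositionalEquality using (_≡_)

-- Revenue values.  The paper uses ℝ≥0; since agda-stdlib has no reals we
-- work over an arbitrary totally ordered commutative monoid (ℝ with + and
-- ≤ is a model), with equality ≡.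

record OrdMonoid : Set₁ where
  infixl 6 _+_
  infix 4 _≤_
  field
    R        : Set
    _+_      : R → R → R
    0r       : R
    _≤_      : R → R → Set
    +-assoc  : ∀ a b c → (a + b) + c ≡ a + (b + c)
    +-comm   : ∀ a b → a + b ≡ b + a
    +-idˡ    : ∀ a → 0r + a ≡ a
    ≤-refl   : ∀ a → a ≤ a
    ≤-trans  : ∀ {a b c} → a ≤ b → b ≤ c → a ≤ c
    ≤-antisym : ∀ {a b} → a ≤ b → b ≤ a → a ≡ b
    ≤-total  : ∀ a b → a ≤ b ⊎ b ≤ a
    +-mono-≤ : ∀ {a b c d} → a ≤ b → c ≤ d → a + c ≤ b + d

module _ (𝓜 : OrdMonoid) where
  open OrdMonoid 𝓜

  sumL : List R → R
  sumL = foldr _+_ 0r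

  -- A general binary CSP (used for the compressed instance, whose vertex
  -- set is not of the form Fin n).  Constraints are given on ordered
  -- pairs of adjacent vertices; verts enumerates the vertex set (each
  -- vertex once) and is used to sum revenues.

  record CSP (V : Set) : Set₁ where
    field
      Adj   : V → V → Set
      Dom   : V → Set
      zeroD : (v : V) → Dom v
      rev   : (v : V) → Dom v → R
      Con   : (u v : V) → Adj u v → Dom u → Dom v → Set
      verts : List V

  module _ {V : Set} (J : CSP V) where
    open CSP J

    IsSolution : ((v : V) → Dom v) → Set
    IsSolution φ = ∀ u v (e : Adj u v) → Con u v e (φ u) (φ v)

    revenue : ((v : V) → Dom v) → R
    revenue φ = sumL (map (λ v → rev v (φ v)) verts)

    IsOptimum : ((v : V) → Dom v) → Set
    IsOptimum φ = IsSolution φ × (∀ ψ → IsSolution ψ → revenue ψ ≤ revenue φ)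

  -- The domain of
  -- u is the finite set Fin (suc (dsize u)), whose element zero plays the
  -- role of the special value 0.

  record Instance (n : ℕ) : Set₁ where
    field
      adj        : Fin n → Fin n → Bool
      adj-sym    : ∀ u v → adj u v ≡ adj v u
      adj-irrefl : ∀ u → adj u u ≡ false
      dsize      : Fin n → ℕ
      rev        : (u : Fin n) → Fin (suc (dsize u)) → R
      rev-zero   : ∀ u → rev u Fin.zero ≡ 0r
      rev-nonneg : ∀ u d → 0r ≤ rev u d
      con        : (u v : Fin n) → T (adj u v) →
                   Fin (suc (dsize u)) → Fin (suc (dsize v)) → Bool
      -- (d , d′) ∈ C_uv  iff  T (con u v e d d′)
      con-zeroˡ  : ∀ u v e d → T (con u v e Fin.zero d)
      con-zeroʳ  : ∀ u v e d → T (con u v e d Fin.zero)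
      con-sym    : ∀ u v e e′ d d′ → (T (con u v e d d′) → T (con v u e′ d′ d))

  module _ {n : ℕ} (I : Instance n) where
    open Instance I

    Dm : Fin n → Set
    Dm u = Fin (suc (dsize u))

    toCSP : CSP (Fin n)
    toCSP = record
      { Adj = λ u v → T (adj u v) ; Dom = Dm ; zeroD = λ _ → Fin.zero
      ; rev = rev ; Con = λ u v e d d′ → T (con u v e d d′) ; verts = List.allFin n }

    revOn : (Fin n → Bool) → ((v : Fin n) → Dm v) → R
    revOn P φ = sumL (map (λ v → if P v then rev v (φ v) else 0r) (List.allFin n))

    IsSolutionOn : (Fin n → Bool) → ((v : Fin n) → Dm v) → Set
    IsSolutionOn Z φ = ∀ u v (e : T (adj u v)) → T (Z u) → T (Z v) →
                       T (con u v e (φ u) (φ v))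

    anyFin : (Fin n → Bool) → Bool
    anyFin P = BLA.any P (List.allFin n)

    module _ (Y : Subset n) where

      data Walk : Fin n → Fin n → Set where
        here : ∀ {u} → u ∉ Y → Walk u u
        step : ∀ {u v w} → Walk u v → T (adj v w) → w ∉ Y → Walk u w

      -- Given a decision procedure for connectivity in G ∖ Y (only its
      -- boolean content is used, which is uniquely determined):
      module _ (conn? : ∀ u v → Dec (Walk u v)) where

        inY : Fin n → Bool
        inY v = lookup Y v

        -- the connected component of G ∖ Y containing c (for c ∉ Y)
        comp : Fin n → Fin n → Bool
        comp c w = does (conn? c w)

        nbhd : Fin n → Subset n
        nbhd c = tabulate (λ v → not (comp c v) ∧ anyFin (λ w → comp c w ∧ adj w v))

        eqSub : Subset n → Subset n → Bool
        eqSub S S′ = does (≡-dec BoolP._≟_ S S′)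

        isNbhd : Subset n → Bool
        isNbhd S = anyFin (λ c → not (inY c) ∧ eqSub (nbhd c) S)

        -- R_S: the union of the components of G ∖ Y with neighbourhood S
        region : Subset n → Fin n → Bool
        region S w = not (inY w) ∧ eqSub (nbhd w) S

        regionS : Subset n → Fin n → Bool
        regionS S w = region S w ∨ lookup S w

        Tuple : Subset n → Set
        Tuple S = (v : Fin n) → v ∈ S → Dm v

        Extends : (S : Subset n) → Tuple S → ((v : Fin n) → Dm v) → Set
        Extends S t φ = ∀ v (p : v ∈ S) → φ v ≡ t v p

        IsCompressedRev : ((S : Subset n) → Tuple S → R) → Set
        IsCompressedRev f = ∀ S → T (isNbhd S) → ∀ (t : Tuple S) →
          (Σ[ φ ∈ ((v : Fin n) → Dm v) ]
              IsSolutionOn (regionS S) φ × Extends S t φ × revOn (region S) φ ≡ f S t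
            × (∀ φ′ → IsSolutionOn (regionS S) φ′ → Extends S t φ′ →
                  revOn (region S) φ′ ≤ f S t))
          ⊎ ((¬ (Σ[ φ ∈ ((v : Fin n) → Dm v) ]
                  (IsSolutionOn (regionS S) φ × Extends S t φ))) × f S t ≡ 0r)

        CVert : Set
        CVert = (Σ[ v ∈ Fin n ] v ∈ Y) ⊎ (Σ[ S ∈ Subset n ] T (isNbhd S))

        allSubsets : (m : ℕ) → List (Subset m)
        allSubsets zero = [] ∷ []
        allSubsets (suc m) = map (true ∷_) (allSubsets m) ++ map (false ∷_) (allSubsets m)

        cverts : List CVert
        cverts = mapMaybe (λ v → yesY v (v ∈? Y)) (List.allFin n)
              ++ mapMaybe (λ S → yesN S (T? (isNbhd S))) (allSubsets n)
          where
          yesY : (v : Fin n) → Dec (v ∈ Y) → Maybe CVert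
          yesY v (yes p) = just (inj₁ (v , p))
          yesY v (no _)  = nothing
          yesN : (S : Subset n) → Dec (T (isNbhd S)) → Maybe CVert
          yesN S (yes p) = just (inj₂ (S , p))
          yesN S (no _)  = nothing

        CAdj : CVert → CVert → Set
        CAdj (inj₁ (u , _)) (inj₁ (v , _)) = T (adj u v)
        CAdj (inj₁ (u , _)) (inj₂ (S , _)) = u ∈ S
        CAdj (inj₂ (S , _)) (inj₁ (u , _)) = u ∈ S
        CAdj (inj₂ _)       (inj₂ _)       = ⊥

        CDom : CVert → Set
        CDom (inj₁ (v , _)) = Dm v
        CDom (inj₂ (S , _)) = Maybe (Tuple S)   -- nothing is the value 0

        CZero : (x : CVert) → CDom x
        CZero (inj₁ _) = Fin.zero
        CZero (inj₂ _) = nothing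

        conUS : (u : Fin n) (S : Subset n) → u ∈ S → Dm u → Maybe (Tuple S) → Set
        conUS u S p d nothing  = ⊤
        conUS u S p d (just t) = d ≡ Fin.zero ⊎ t u p ≡ d

        CCon : (x y : CVert) → CAdj x y → CDom x → CDom y → Set
        CCon (inj₁ (u , _)) (inj₁ (v , _)) e d d′ = T (con u v e d d′)
        CCon (inj₁ (u , _)) (inj₂ (S , _)) p d e  = conUS u S p d e
        CCon (inj₂ (S , _)) (inj₁ (u , _)) p e d  = conUS u S p d e
        CCon (inj₂ _)       (inj₂ _)       () _ _

        compressed : ((S : Subset n) → Tuple S → R) → CSP CVert
        compressed f = record
          { Adj = CAdj ; Dom = CDom ; zeroD = CZero
          ; rev = crev ; Con = CCon ; verts = cverts }
          where
          crev : (x : CVert) → CDom x → R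
          crev (inj₁ (v , _)) d        = rev v d
          crev (inj₂ (S , _)) nothing  = 0r
          crev (inj₂ (S , _)) (just t) = f S t

{-# OPTIONS --safe #-}
module Submission where

-- A solution φ of I compresses to the solution of I{Y} that agrees with φ on Y and assigns
-- to each neighbourhood vertex S the tuple φ|S.  Every vertex outside Y lies in exactly one
-- region R_S, and rev′_S bounds the revenue of φ on R_S, so compression does not decrease
-- revenue.  Conversely, a solution ψ of I{Y} decompresses by filling each region R_S with an
-- optimal extension of the tuple ψ(S) (or with 0); adjacent vertices outside Y lie in the
-- same region, so this is a solution of I, of the same revenue.  I is finite, so it has an
-- optimum, and the two maps transfer optimality and revenue in both directions.

open import Defs
open import Data.Nat using (ℕ; zero; suc)
open import Data.Fin using (Fin) renaming (zero to fz; suc to fs)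
open import Data.Fin.Subset using (Subset; _∈_; _∉_)
open import Data.Fin.Subset.Properties using (_∈?_)
open import Data.Bool using (Bool; true; false; T; not; _∧_; if_then_else_; _≟_)
open import Data.Bool.Properties using (T-≡; T-∧; T-∨; T-irrelevant)
open import Data.List using (List; []; _∷_; _++_; map; mapMaybe; allFin)
open import Data.List.Properties using (map-cong)
open import Data.Bool.ListAction using (or)
open import Data.List.Relation.Unary.Any.Properties using (any⁺)
open import Data.List.Membership.Propositional using (lose)
open import Data.List.Membership.Propositional.Properties using (∈-allFin)
open import Data.Vec using ([]; _∷_; lookup)
open import Data.Vec.Properties using (∷-injectiveʳ; ≡-dec; []=⇒lookup; lookup⇒[]=; lookup∘tabulate; tabulate-cong)
open import Data.Maybe using (Maybe; just; nothing; maybe)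
open import Data.Product using (Σ-syntax; _×_; _,_; proj₁; proj₂)
open import Data.Sum using (inj₁; inj₂)
open import Data.Empty using (⊥-elim)
open import Relation.Nullary using (Dec; yes; no; ¬_; does)
open import Relation.Nullary.Decidable using (dec-true; does-⇔; T?; map′)
open import Data.Fin.Properties using (all?)
open import Relation.Binary.Bundles using (Preorder)
import Relation.Binary.Reasoning.Preorder as PreorderReasoning
open import Function.Bundles using (Equivalence; mk⇔)
open import Relation.Binary.PropositionalEquality

T-does⇒ : {P : Set} (P? : Dec P) → T (does P?) → P
T-does⇒ (yes p) _ = p

⇒T-does : {P : Set} (P? : Dec P) → P → T (does P?)
⇒T-does P? p = Equivalence.from T-≡ (dec-true P? p)

T-not⇒¬T : ∀ {b} → T (not b) → ¬ T b
T-not⇒¬T {true} () _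

¬T⇒T-not : ∀ {b} → ¬ T b → T (not b)
¬T⇒T-not {true}  ¬b = ¬b _
¬T⇒T-not {false} ¬b = _

if-T : ∀ {A : Set} b {x y : A} → T b → (if b then x else y) ≡ x
if-T true _ = refl

if-¬T : ∀ {A : Set} b {x y : A} → ¬ T b → (if b then x else y) ≡ y
if-¬T true  ¬b = ⊥-elim (¬b _)
if-¬T false ¬b = refl

∈⇒T-lookup : ∀ {n} {v : Fin n} {S : Subset n} → v ∈ S → T (lookup S v)
∈⇒T-lookup v∈S = Equivalence.from T-≡ ([]=⇒lookup v∈S)

T-lookup⇒∈ : ∀ {n} {v : Fin n} {S : Subset n} → T (lookup S v) → v ∈ S
T-lookup⇒∈ {v = v} {S} t = lookup⇒[]= v S (Equivalence.to T-≡ t)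

Π-T? : ∀ b {P : T b → Set} → (∀ t → Dec (P t)) → Dec (∀ t → P t)
Π-T? false P? = yes λ ()
Π-T? true  P? = map′ (λ p _ → p) (λ f → f _) (P? _)

module Sums (𝓜 : OrdMonoid) where
  open OrdMonoid 𝓜

  ≡⇒≤ : ∀ {a b} → a ≡ b → a ≤ b
  ≡⇒≤ {a} refl = ≤-refl a

  ≤-preorder : Preorder _ _ _
  ≤-preorder = record
    { Carrier = R ; _≈_ = _≡_ ; _≲_ = _≤_
    ; isPreorder = record { isEquivalence = isEquivalence ; reflexive = ≡⇒≤ ; trans = ≤-trans } }

  module ≤-Reasoning = PreorderReasoning ≤-preorder

  +-identityʳ : ∀ a → a + 0r ≡ a
  +-identityʳ a = trans (+-comm a 0r) (+-idˡ a)

  +-interchange : ∀ a b c d → (a + b) + (c + d) ≡ (a + c) + (b + d)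
  +-interchange a b c d = begin
    (a + b) + (c + d)  ≡⟨ +-assoc a b (c + d) ⟩
    a + (b + (c + d))  ≡⟨ cong (a +_) (sym (+-assoc b c d)) ⟩
    a + ((b + c) + d)  ≡⟨ cong (λ x → a + (x + d)) (+-comm b c) ⟩
    a + ((c + b) + d)  ≡⟨ cong (a +_) (+-assoc c b d) ⟩
    a + (c + (b + d))  ≡⟨ sym (+-assoc a c (b + d)) ⟩
    (a + c) + (b + d)  ∎
    where open ≡-Reasoning

  ∑ : {A : Set} → (A → R) → List A → R
  ∑ f xs = sumL 𝓜 (map f xs)

  ∑-cong : {A : Set} {f g : A → R} (xs : List A) → (∀ x → f x ≡ g x) → ∑ f xs ≡ ∑ g xs
  ∑-cong []       f≗g = refl
  ∑-cong (x ∷ xs) f≗g = cong₂ _+_ (f≗g x) (∑-cong xs f≗g)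

  ∑-mono : {A : Set} {f g : A → R} (xs : List A) → (∀ x → f x ≤ g x) → ∑ f xs ≤ ∑ g xs
  ∑-mono []       f≤g = ≤-refl 0r
  ∑-mono (x ∷ xs) f≤g = +-mono-≤ (f≤g x) (∑-mono xs f≤g)

  ∑-zero : {A : Set} {f : A → R} (xs : List A) → (∀ x → f x ≡ 0r) → ∑ f xs ≡ 0r
  ∑-zero []       f≗0 = refl
  ∑-zero (x ∷ xs) f≗0 = trans (cong₂ _+_ (f≗0 x) (∑-zero xs f≗0)) (+-idˡ 0r)

  ∑-++ : {A : Set} (f : A → R) (xs ys : List A) → ∑ f (xs ++ ys) ≡ ∑ f xs + ∑ f ys
  ∑-++ f []       ys = sym (+-idˡ _)
  ∑-++ f (x ∷ xs) ys = trans (cong (f x +_) (∑-++ f xs ys)) (sym (+-assoc _ _ _))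

  ∑-map : {A B : Set} (f : B → R) (g : A → B) (xs : List A) → ∑ f (map g xs) ≡ ∑ (λ x → f (g x)) xs
  ∑-map f g []       = refl
  ∑-map f g (x ∷ xs) = cong (f (g x) +_) (∑-map f g xs)

  ∑-mapMaybe : {A B : Set} (f : B → R) (g : A → Maybe B) (xs : List A) →
    ∑ f (mapMaybe g xs) ≡ ∑ (λ x → maybe f 0r (g x)) xs
  ∑-mapMaybe f g []       = refl
  ∑-mapMaybe f g (x ∷ xs) with g x
  ... | just y  = cong (f y +_) (∑-mapMaybe f g xs)
  ... | nothing = trans (∑-mapMaybe f g xs) (sym (+-idˡ _))

  ∑-+ : {A : Set} (f g : A → R) (xs : List A) → ∑ (λ x → f x + g x) xs ≡ ∑ f xs + ∑ g xs
  ∑-+ f g []       = sym (+-idˡ 0r)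
  ∑-+ f g (x ∷ xs) = trans (cong (f x + g x +_) (∑-+ f g xs)) (+-interchange _ _ _ _)

  ∑-comm : {A B : Set} (f : A → B → R) (xs : List A) (ys : List B) →
    ∑ (λ x → ∑ (f x) ys) xs ≡ ∑ (λ y → ∑ (λ x → f x y) xs) ys
  ∑-comm f []       ys = sym (∑-zero ys (λ _ → refl))
  ∑-comm f (x ∷ xs) ys = trans (cong (∑ (f x) ys +_) (∑-comm f xs ys))
    (sym (∑-+ (f x) (λ y → ∑ (λ x → f x y) xs) ys))

  onYes : {P : Set} → Dec P → (P → R) → R
  onYes (yes p) f = f p
  onYes (no _)  f = 0r

  onYes-mono : {P : Set} (P? : Dec P) {f g : P → R} → (∀ p → f p ≤ g p) → onYes P? f ≤ onYes P? g
  onYes-mono (yes p) f≤g = f≤g p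
  onYes-mono (no _)  f≤g = ≤-refl 0r

  onYes-cong : {P : Set} (P? : Dec P) {f g : P → R} → (∀ p → f p ≡ g p) → onYes P? f ≡ onYes P? g
  onYes-cong (yes p) f≗g = f≗g p
  onYes-cong (no _)  f≗g = refl

  onYes-zero : {P : Set} (P? : Dec P) {f : P → R} → (∀ p → f p ≡ 0r) → onYes P? f ≡ 0r
  onYes-zero (yes p) f≗0 = f≗0 p
  onYes-zero (no _)  f≗0 = refl

  onYes-const : {P : Set} (P? : Dec P) {a : R} → P → onYes P? (λ _ → a) ≡ a
  onYes-const (yes _) p = refl
  onYes-const (no ¬p) p = ⊥-elim (¬p p)

  ∑-onYes : {A : Set} {P : Set} (P? : Dec P) (f : P → A → R) (xs : List A) →
    ∑ (λ x → onYes P? (λ p → f p x)) xs ≡ onYes P? (λ p → ∑ (f p) xs)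
  ∑-onYes (yes p) f xs = refl
  ∑-onYes (no _)  f xs = ∑-zero xs (λ _ → refl)

module Maximum (𝓜 : OrdMonoid) where
  open OrdMonoid 𝓜
  open Sums 𝓜 using (≡⇒≤)

  Fin-argmax : ∀ m (h : Fin (suc m) → R) → Σ[ i ∈ Fin (suc m) ] (∀ j → h j ≤ h i)
  Fin-argmax zero    h = fz , λ { fz → ≤-refl _ }
  Fin-argmax (suc m) h with Fin-argmax m (λ j → h (fs j))
  ... | i , hi with ≤-total (h fz) (h (fs i))
  ...   | inj₁ h₀≤ = fs i , λ { fz → h₀≤ ; (fs j) → hi j }
  ...   | inj₂ ≤h₀ = fz   , λ { fz → ≤-refl _ ; (fs j) → ≤-trans (hi j) ≤h₀ }

  Choice : ∀ k → (Fin k → ℕ) → Set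
  Choice k d = (i : Fin k) → Fin (suc (d i))

  Extensional : ∀ {k d} → (Choice k d → R) → Set
  Extensional g = ∀ φ ψ → (∀ i → φ i ≡ ψ i) → g φ ≡ g ψ

  cons : ∀ {k} {d : Fin (suc k) → ℕ} → Fin (suc (d fz)) → Choice k (λ i → d (fs i)) → Choice (suc k) d
  cons a t fz     = a
  cons a t (fs i) = t i

  Choice-argmax : ∀ k (d : Fin k → ℕ) (g : Choice k d → R) → Extensional g →
    Σ[ φ ∈ Choice k d ] (∀ ψ → g ψ ≤ g φ)
  Choice-argmax zero    d g g-ext = (λ ()) , λ ψ → ≡⇒≤ (g-ext ψ _ (λ ()))
  Choice-argmax (suc k) d g g-ext = cons a* (best-tail a*) , bound
    where
    tail-argmax : ∀ a → Σ[ t ∈ Choice k (λ i → d (fs i)) ] (∀ t′ → g (cons a t′) ≤ g (cons a t))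
    tail-argmax a = Choice-argmax k (λ i → d (fs i)) (λ t → g (cons a t))
      (λ φ ψ φ≗ψ → g-ext _ _ λ { fz → refl ; (fs i) → φ≗ψ i })
    best-tail : ∀ a → Choice k (λ i → d (fs i))
    best-tail a = proj₁ (tail-argmax a)
    head-argmax : Σ[ a ∈ Fin (suc (d fz)) ] (∀ b → g (cons b (best-tail b)) ≤ g (cons a (best-tail a)))
    head-argmax = Fin-argmax (d fz) (λ a → g (cons a (best-tail a)))
    a* : Fin (suc (d fz))
    a* = proj₁ head-argmax
    bound : ∀ ψ → g ψ ≤ g (cons a* (best-tail a*))
    bound ψ = ≤-trans (≡⇒≤ (g-ext ψ (cons (ψ fz) (λ i → ψ (fs i))) λ { fz → refl ; (fs i) → refl }))
              (≤-trans (proj₂ (tail-argmax (ψ fz)) (λ i → ψ (fs i))) (proj₂ head-argmax (ψ fz)))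

  -- Maximise the score that is g on P and the constant g φ₀ elsewhere: if the maximiser
  -- lies outside P, then φ₀ itself maximises g on P.
  Choice-argmax-on : ∀ {k d} (P : Choice k d → Set) → (∀ φ → Dec (P φ)) →
    (∀ φ ψ → (∀ i → φ i ≡ ψ i) → P φ → P ψ) →
    (g : Choice k d → R) → Extensional g → ∀ φ₀ → P φ₀ →
    Σ[ φ ∈ Choice k d ] (P φ × (∀ ψ → P ψ → g ψ ≤ g φ))
  Choice-argmax-on {k} {d} P P? P-ext g g-ext φ₀ Pφ₀ =
    from-argmax (proj₁ best) (proj₂ best) (P? (proj₁ best))
    where
    score : Choice k d → R
    score φ with P? φ
    ... | yes _ = g φ
    ... | no _  = g φ₀
    score-on : ∀ ψ → P ψ → score ψ ≡ g ψ
    score-on ψ Pψ with P? ψ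
    ... | yes _  = refl
    ... | no ¬Pψ = ⊥-elim (¬Pψ Pψ)
    score-off : ∀ ψ → ¬ P ψ → score ψ ≡ g φ₀
    score-off ψ ¬Pψ with P? ψ
    ... | yes Pψ = ⊥-elim (¬Pψ Pψ)
    ... | no _   = refl
    score-ext : Extensional score
    score-ext φ ψ φ≗ψ with P? φ | P? ψ
    ... | yes _  | yes _  = g-ext φ ψ φ≗ψ
    ... | yes Pφ | no ¬Pψ = ⊥-elim (¬Pψ (P-ext φ ψ φ≗ψ Pφ))
    ... | no ¬Pφ | yes Pψ = ⊥-elim (¬Pφ (P-ext ψ φ (λ i → sym (φ≗ψ i)) Pψ))
    ... | no _   | no _   = refl
    best : Σ[ φ ∈ Choice k d ] (∀ ψ → score ψ ≤ score φ)
    best = Choice-argmax k d score score-ext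
    below : ∀ φ → (∀ ψ → score ψ ≤ score φ) → ∀ ψ → P ψ → g ψ ≤ score φ
    below φ max ψ Pψ = ≤-trans (≡⇒≤ (sym (score-on ψ Pψ))) (max ψ)
    from-argmax : ∀ φ → (∀ ψ → score ψ ≤ score φ) → Dec (P φ) →
      Σ[ φ ∈ Choice k d ] (P φ × (∀ ψ → P ψ → g ψ ≤ g φ))
    from-argmax φ max (yes Pφ) = φ  , Pφ  , λ ψ Pψ → ≤-trans (below φ max ψ Pψ) (≡⇒≤ (score-on φ Pφ))
    from-argmax φ max (no ¬Pφ) = φ₀ , Pφ₀ , λ ψ Pψ → ≤-trans (below φ max ψ Pψ) (≡⇒≤ (score-off φ ¬Pφ))

module Solutions (𝓜 : OrdMonoid) {n : ℕ} (I : Instance 𝓜 n) where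
  open OrdMonoid 𝓜
  open Instance I
  open Sums 𝓜
  open Maximum 𝓜 using (Extensional; Choice-argmax-on)

  IC : CSP 𝓜 (Fin n)
  IC = toCSP 𝓜 I

  Assignment : Set
  Assignment = (v : Fin n) → Dm 𝓜 I v

  adj-flip : ∀ {u v} → T (adj u v) → T (adj v u)
  adj-flip {u} {v} = subst T (adj-sym u v)

  zeroAssignment : Assignment
  zeroAssignment _ = fz

  zeroAssignment-solutionOn : ∀ Z → IsSolutionOn 𝓜 I Z zeroAssignment
  zeroAssignment-solutionOn Z u v e _ _ = con-zeroˡ u v e fz

  revOn-zeroAssignment : ∀ P → revOn 𝓜 I P zeroAssignment ≡ 0r
  revOn-zeroAssignment P = ∑-zero (allFin n) vertex-zero
    where
    vertex-zero : ∀ v → (if P v then rev v fz else 0r) ≡ 0r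
    vertex-zero v with P v
    ... | true  = rev-zero v
    ... | false = refl

  solution⇒solutionOn : ∀ {φ} Z → IsSolution 𝓜 IC φ → IsSolutionOn 𝓜 I Z φ
  solution⇒solutionOn Z sφ u v e _ _ = sφ u v e

  revOn-cong : ∀ P {φ φ′ : Assignment} → (∀ w → T (P w) → φ w ≡ φ′ w) → revOn 𝓜 I P φ ≡ revOn 𝓜 I P φ′
  revOn-cong P {φ} {φ′} φ≗φ′ = ∑-cong (allFin n) vertex-term
    where
    vertex-term : ∀ w → (if P w then rev w (φ w) else 0r) ≡ (if P w then rev w (φ′ w) else 0r)
    vertex-term w with P w | φ≗φ′ w
    ... | true  | eq = cong (rev w) (eq _)
    ... | false | _  = refl

  IsSolution? : ∀ φ → Dec (IsSolution 𝓜 IC φ)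
  IsSolution? φ = all? λ u → all? λ v → Π-T? (adj u v) λ e → T? (con u v e (φ u) (φ v))

  optimum-exists : Σ[ φ ∈ Assignment ] IsOptimum 𝓜 IC φ
  optimum-exists = Choice-argmax-on (IsSolution 𝓜 IC) IsSolution? solution-ext
                     (revenue 𝓜 IC) revenue-ext zeroAssignment zeroAssignment-solution
    where
    solution-ext : ∀ φ φ′ → (∀ v → φ v ≡ φ′ v) → IsSolution 𝓜 IC φ → IsSolution 𝓜 IC φ′
    solution-ext φ φ′ φ≗φ′ sφ u v e = subst₂ (λ a b → T (con u v e a b)) (φ≗φ′ u) (φ≗φ′ v) (sφ u v e)
    revenue-ext : Extensional (revenue 𝓜 IC)
    revenue-ext φ φ′ φ≗φ′ = ∑-cong (allFin n) λ v → cong (rev v) (φ≗φ′ v)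
    zeroAssignment-solution : IsSolution 𝓜 IC zeroAssignment
    zeroAssignment-solution u v e = con-zeroˡ u v e fz

module Regions (𝓜 : OrdMonoid) {n : ℕ} (I : Instance 𝓜 n) (Y : Subset n)
  (conn? : ∀ u v → Dec (Walk 𝓜 I Y u v)) where
  open OrdMonoid 𝓜
  open Instance I
  open Sums 𝓜
  open Solutions 𝓜 I

  N : Fin n → Subset n
  N = nbhd 𝓜 I Y conn?

  IsN : Subset n → Set
  IsN S = T (isNbhd 𝓜 I Y conn? S)

  isN? : ∀ S → Dec (IsN S)
  isN? S = T? (isNbhd 𝓜 I Y conn? S)

  Region : Subset n → Fin n → Bool
  Region = region 𝓜 I Y conn?

  RegionS : Subset n → Fin n → Bool
  RegionS = regionS 𝓜 I Y conn?

  Region⊆RegionS : ∀ {S w} → T (Region S w) → T (RegionS S w)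
  Region⊆RegionS t = Equivalence.from T-∨ (inj₁ t)

  ∈⇒RegionS : ∀ {S u} → u ∈ S → T (RegionS S u)
  ∈⇒RegionS u∈S = Equivalence.from T-∨ (inj₂ (∈⇒T-lookup u∈S))

  subsets : List (Subset n)
  subsets = allSubsets 𝓜 I Y conn? n

  walk-end∉ : ∀ {u v} → Walk 𝓜 I Y u v → v ∉ Y
  walk-end∉ (here v∉Y)     = v∉Y
  walk-end∉ (step _ _ v∉Y) = v∉Y

  walk-prepend : ∀ {x u v} → T (adj x u) → x ∉ Y → Walk 𝓜 I Y u v → Walk 𝓜 I Y x v
  walk-prepend e x∉Y (here u∉Y)       = step (here x∉Y) e u∉Y
  walk-prepend e x∉Y (step w e′ v∉Y)  = step (walk-prepend e x∉Y w) e′ v∉Y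

  T-anyFin : (P : Fin n → Bool) (w : Fin n) → T (P w) → T (anyFin 𝓜 I P)
  T-anyFin P w Pw = any⁺ P (lose (∈-allFin w) Pw)

  ∉⇒T-notY : ∀ {v} → v ∉ Y → T (not (lookup Y v))
  ∉⇒T-notY v∉Y = ¬T⇒T-not (λ t → v∉Y (T-lookup⇒∈ t))

  comp-adj : ∀ {v v′} → v ∉ Y → v′ ∉ Y → T (adj v v′) → ∀ w → comp 𝓜 I Y conn? v w ≡ comp 𝓜 I Y conn? v′ w
  comp-adj v∉Y v′∉Y e w =
    does-⇔ (mk⇔ (walk-prepend (adj-flip e) v′∉Y) (walk-prepend e v∉Y)) (conn? _ w) (conn? _ w)

  N-adj : ∀ {v v′} → v ∉ Y → v′ ∉ Y → T (adj v v′) → N v ≡ N v′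
  N-adj v∉Y v′∉Y e = tabulate-cong λ u →
    cong₂ _∧_ (cong not (comp-adj v∉Y v′∉Y e u))
              (cong or (map-cong (λ w → cong (_∧ adj w u) (comp-adj v∉Y v′∉Y e w)) (allFin n)))

  ∈-N : ∀ {u v} → u ∈ Y → v ∉ Y → T (adj v u) → u ∈ N v
  ∈-N {u} {v} u∈Y v∉Y e = lookup⇒[]= u (N v) (trans (lookup∘tabulate _ u) (Equivalence.to T-≡
    (Equivalence.from T-∧
      ( ¬T⇒T-not (λ t → walk-end∉ (T-does⇒ (conn? v u) t) u∈Y)
      , T-anyFin _ v (Equivalence.from T-∧ (⇒T-does (conn? v v) (here v∉Y) , e))))))

  IsN-N : ∀ {v} → v ∉ Y → IsN (N v)
  IsN-N {v} v∉Y = T-anyFin _ v (Equivalence.from T-∧ (∉⇒T-notY v∉Y , ⇒T-does (≡-dec _≟_ (N v) (N v)) refl))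

  ∈-Region : ∀ {w} → w ∉ Y → T (Region (N w) w)
  ∈-Region {w} w∉Y = Equivalence.from T-∧ (∉⇒T-notY w∉Y , ⇒T-does (≡-dec _≟_ (N w) (N w)) refl)

  Region⇒ : ∀ {S w} → T (Region S w) → w ∉ Y × N w ≡ S
  Region⇒ {S} {w} t with Equivalence.to T-∧ t
  ... | w∉ , N≡ = (λ w∈Y → T-not⇒¬T w∉ (∈⇒T-lookup w∈Y)) , T-does⇒ (≡-dec _≟_ (N w) S) N≡

  ∑-allSubsets-suc : ∀ m (g : Subset (suc m) → R) → ∑ g (allSubsets 𝓜 I Y conn? (suc m)) ≡
    ∑ (λ S → g (true ∷ S)) (allSubsets 𝓜 I Y conn? m) + ∑ (λ S → g (false ∷ S)) (allSubsets 𝓜 I Y conn? m)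
  ∑-allSubsets-suc m g = trans (∑-++ g (map (true ∷_) Sm) (map (false ∷_) Sm))
                               (cong₂ _+_ (∑-map g (true ∷_) Sm) (∑-map g (false ∷_) Sm))
    where
    Sm : List (Subset m)
    Sm = allSubsets 𝓜 I Y conn? m

  ∑-allSubsets-single : ∀ m (g : Subset m → R) S₀ → (∀ S → S ≢ S₀ → g S ≡ 0r) →
    ∑ g (allSubsets 𝓜 I Y conn? m) ≡ g S₀
  ∑-allSubsets-single zero    g []          g≗0 = +-identityʳ (g [])
  ∑-allSubsets-single (suc m) g (true ∷ S₀) g≗0 = trans (∑-allSubsets-suc m g)
    (trans (cong₂ _+_ (∑-allSubsets-single m _ S₀ λ S S≢ → g≗0 _ λ eq → S≢ (∷-injectiveʳ eq))
                      (∑-zero (allSubsets 𝓜 I Y conn? m) λ S → g≗0 (false ∷ S) λ ()))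
           (+-identityʳ _))
  ∑-allSubsets-single (suc m) g (false ∷ S₀) g≗0 = trans (∑-allSubsets-suc m g)
    (trans (cong₂ _+_ (∑-zero (allSubsets 𝓜 I Y conn? m) λ S → g≗0 (true ∷ S) λ ())
                      (∑-allSubsets-single m _ S₀ λ S S≢ → g≗0 _ λ eq → S≢ (∷-injectiveʳ eq)))
           (+-idˡ _))

  revOnY : Assignment → Fin n → R
  revOnY φ v = onYes (v ∈? Y) (λ _ → rev v (φ v))

  revOnN : Assignment → Subset n → Fin n → R
  revOnN φ S w = onYes (isN? S) (λ _ → if Region S w then rev w (φ w) else 0r)

  -- each vertex outside Y lies in exactly one region, namely that of N w
  rev-decompose : ∀ φ w → rev w (φ w) ≡ revOnY φ w + ∑ (λ S → revOnN φ S w) subsets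
  rev-decompose φ w with w ∈? Y
  ... | yes w∈Y = sym (trans (cong (rev w (φ w) +_) (∑-zero subsets outside)) (+-identityʳ _))
    where
    outside : ∀ S → revOnN φ S w ≡ 0r
    outside S = onYes-zero (isN? S) λ _ → if-¬T (Region S w) λ t → proj₁ (Region⇒ t) w∈Y
  ... | no w∉Y = sym (trans (+-idˡ _) (trans (∑-allSubsets-single n (λ S → revOnN φ S w) (N w) other) own))
    where
    other : ∀ S → S ≢ N w → revOnN φ S w ≡ 0r
    other S S≢ = onYes-zero (isN? S) λ _ → if-¬T (Region S w) λ t → S≢ (sym (proj₂ (Region⇒ t)))
    own : revOnN φ (N w) w ≡ rev w (φ w)
    own = trans (onYes-const (isN? (N w)) (IsN-N w∉Y)) (if-T (Region (N w) w) (∈-Region w∉Y))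

  revenue-split : ∀ φ → revenue 𝓜 IC φ ≡
    ∑ (revOnY φ) (allFin n) + ∑ (λ S → onYes (isN? S) (λ _ → revOn 𝓜 I (Region S) φ)) subsets
  revenue-split φ = begin
    ∑ (λ w → rev w (φ w)) (allFin n)
      ≡⟨ ∑-cong (allFin n) (rev-decompose φ) ⟩
    ∑ (λ w → revOnY φ w + ∑ (λ S → revOnN φ S w) subsets) (allFin n)
      ≡⟨ ∑-+ (revOnY φ) _ (allFin n) ⟩
    ∑ (revOnY φ) (allFin n) + ∑ (λ w → ∑ (λ S → revOnN φ S w) subsets) (allFin n)
      ≡⟨ cong (∑ (revOnY φ) (allFin n) +_) (∑-comm (λ w S → revOnN φ S w) (allFin n) subsets) ⟩
    ∑ (revOnY φ) (allFin n) + ∑ (λ S → ∑ (revOnN φ S) (allFin n)) subsets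
      ≡⟨ cong (∑ (revOnY φ) (allFin n) +_) (∑-cong subsets λ S → ∑-onYes (isN? S) _ (allFin n)) ⟩
    ∑ (revOnY φ) (allFin n) + ∑ (λ S → onYes (isN? S) (λ _ → revOn 𝓜 I (Region S) φ)) subsets ∎
    where open ≡-Reasoning

module Compression (𝓜 : OrdMonoid) {n : ℕ} (I : Instance 𝓜 n) (Y : Subset n)
  (conn? : ∀ u v → Dec (Walk 𝓜 I Y u v))
  (rev′ : (S : Subset n) → Tuple 𝓜 I Y conn? S → OrdMonoid.R 𝓜)
  (rev′-max : IsCompressedRev 𝓜 I Y conn? rev′) where
  open OrdMonoid 𝓜
  open Instance I
  open Sums 𝓜
  open Solutions 𝓜 I
  open Regions 𝓜 I Y conn?

  IY : CSP 𝓜 (CVert 𝓜 I Y conn?)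
  IY = compressed 𝓜 I Y conn? rev′

  AssignmentY : Set
  AssignmentY = (x : CVert 𝓜 I Y conn?) → CDom 𝓜 I Y conn? x

  revIY : (x : CVert 𝓜 I Y conn?) → CDom 𝓜 I Y conn? x → R
  revIY = CSP.rev IY

  -- names the two enumerating functions, which are local to the definition of cverts
  cverts-split : Σ[ g ∈ (Fin n → Maybe (CVert 𝓜 I Y conn?)) ] Σ[ h ∈ (Subset n → Maybe (CVert 𝓜 I Y conn?)) ]
    cverts 𝓜 I Y conn? ≡ mapMaybe g (allFin n) ++ mapMaybe h subsets
  cverts-split = _ , _ , refl

  revenue-split-compressed : ∀ ψ → revenue 𝓜 IY ψ ≡
      ∑ (λ v → onYes (v ∈? Y) (λ p → revIY (inj₁ (v , p)) (ψ (inj₁ (v , p))))) (allFin n)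
    + ∑ (λ S → onYes (isN? S) (λ p → revIY (inj₂ (S , p)) (ψ (inj₂ (S , p))))) subsets
  revenue-split-compressed ψ =
    trans (∑-++ f (mapMaybe g (allFin n)) (mapMaybe h subsets))
          (cong₂ _+_ (trans (∑-mapMaybe f g (allFin n)) (∑-cong (allFin n) vertex-term))
                     (trans (∑-mapMaybe f h subsets) (∑-cong subsets nbhd-term)))
    where
    f : CVert 𝓜 I Y conn? → R
    f x = revIY x (ψ x)
    g : Fin n → Maybe (CVert 𝓜 I Y conn?)
    g = proj₁ cverts-split
    h : Subset n → Maybe (CVert 𝓜 I Y conn?)
    h = proj₁ (proj₂ cverts-split)
    vertex-term : ∀ v → maybe f 0r (g v) ≡ onYes (v ∈? Y) (λ p → f (inj₁ (v , p)))
    vertex-term v with v ∈? Y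
    ... | yes _ = refl
    ... | no _  = refl
    nbhd-term : ∀ S → maybe f 0r (h S) ≡ onYes (isN? S) (λ p → f (inj₂ (S , p)))
    nbhd-term S with isN? S
    ... | yes _ = refl
    ... | no _  = refl

  compress : Assignment → AssignmentY
  compress φ (inj₁ (v , _)) = φ v
  compress φ (inj₂ (S , _)) = just (λ v _ → φ v)

  compress-solution : ∀ {φ} → IsSolution 𝓜 IC φ → IsSolution 𝓜 IY (compress φ)
  compress-solution sφ (inj₁ (u , _)) (inj₁ (v , _)) e = sφ u v e
  compress-solution sφ (inj₁ _)       (inj₂ _)       _ = inj₂ refl
  compress-solution sφ (inj₂ _)       (inj₁ _)       _ = inj₂ refl

  region-revenue≤rev′ : ∀ {φ} → IsSolution 𝓜 IC φ → ∀ S (p : IsN S) →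
    revOn 𝓜 I (Region S) φ ≤ rev′ S (λ v _ → φ v)
  region-revenue≤rev′ {φ} sφ S p with rev′-max S p (λ v _ → φ v)
  ... | inj₁ (_ , _ , _ , _ , max) = max φ (solution⇒solutionOn _ sφ) (λ _ _ → refl)
  ... | inj₂ (no-extension , _)    = ⊥-elim (no-extension (φ , solution⇒solutionOn _ sφ , λ _ _ → refl))

  compress-revenue : ∀ {φ} → IsSolution 𝓜 IC φ → revenue 𝓜 IC φ ≤ revenue 𝓜 IY (compress φ)
  compress-revenue {φ} sφ = begin
    revenue 𝓜 IC φ
      ≡⟨ revenue-split φ ⟩
    ∑ (revOnY φ) (allFin n) + ∑ (λ S → onYes (isN? S) (λ _ → revOn 𝓜 I (Region S) φ)) subsets
      ≲⟨ +-mono-≤ (≤-refl _) (∑-mono subsets λ S → onYes-mono (isN? S) (region-revenue≤rev′ sφ S)) ⟩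
    ∑ (revOnY φ) (allFin n) + ∑ (λ S → onYes (isN? S) (λ _ → rev′ S (λ v _ → φ v))) subsets
      ≡⟨ revenue-split-compressed (compress φ) ⟨
    revenue 𝓜 IY (compress φ) ∎
    where open ≤-Reasoning

  extend : ∀ S → IsN S → Maybe (Tuple 𝓜 I Y conn? S) → Assignment
  extend S p nothing  = zeroAssignment
  extend S p (just t) with rev′-max S p t
  ... | inj₁ (φ , _) = φ
  ... | inj₂ _       = zeroAssignment

  extend-solutionOn : ∀ S p mt → IsSolutionOn 𝓜 I (RegionS S) (extend S p mt)
  extend-solutionOn S p nothing  = zeroAssignment-solutionOn _
  extend-solutionOn S p (just t) with rev′-max S p t
  ... | inj₁ (_ , sφ , _) = sφ
  ... | inj₂ _            = zeroAssignment-solutionOn _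

  extend-revenue : ∀ S p mt → revIY (inj₂ (S , p)) mt ≡ revOn 𝓜 I (Region S) (extend S p mt)
  extend-revenue S p nothing  = sym (revOn-zeroAssignment _)
  extend-revenue S p (just t) with rev′-max S p t
  ... | inj₁ (_ , _ , _ , rev≡ , _) = sym rev≡
  ... | inj₂ (_ , rev′≡0)           = trans rev′≡0 (sym (revOn-zeroAssignment _))

  extend-boundary : ∀ {u v} (e : T (adj u v)) S p (u∈S : u ∈ S) d mt →
    conUS 𝓜 I Y conn? u S u∈S d mt → T (Region S v) → T (con u v e d (extend S p mt v))
  extend-boundary e S p u∈S d nothing  _ _ = con-zeroʳ _ _ e d
  extend-boundary e S p u∈S d (just t) c v∈R with rev′-max S p t
  ... | inj₂ _ = con-zeroʳ _ _ e d
  ... | inj₁ (φ , sφ , φ-ext , _) with c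
  ...   | inj₁ refl = con-zeroˡ _ _ e _
  ...   | inj₂ t≡d  = subst (λ x → T (con _ _ e x (φ _))) (trans (φ-ext _ u∈S) t≡d)
                            (sφ _ _ e (∈⇒RegionS u∈S) (Region⊆RegionS v∈R))

  module _ (ψ : AssignmentY) where

    extendAt : ∀ S → IsN S → Assignment
    extendAt S p = extend S p (ψ (inj₂ (S , p)))

    decompress : Assignment
    decompress v with v ∈? Y
    ... | yes v∈Y = ψ (inj₁ (v , v∈Y))
    ... | no v∉Y  = extendAt (N v) (IsN-N v∉Y) v

    extendAt-cong : ∀ {S S′} → S ≡ S′ → ∀ p p′ w → extendAt S p w ≡ extendAt S′ p′ w
    extendAt-cong {S} refl p p′ w rewrite T-irrelevant p p′ = refl

    extendAt-Region : ∀ S p w → T (Region S w) → extendAt S p w ≡ decompress w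
    extendAt-Region S p w w∈R with w ∈? Y
    ... | yes w∈Y = ⊥-elim (proj₁ (Region⇒ w∈R) w∈Y)
    ... | no w∉Y  = extendAt-cong (sym (proj₂ (Region⇒ w∈R))) p (IsN-N w∉Y) w

    decompress-boundary : IsSolution 𝓜 IY ψ → ∀ {u v} (e : T (adj u v)) (u∈Y : u ∈ Y) (v∉Y : v ∉ Y) →
      T (con u v e (ψ (inj₁ (u , u∈Y))) (extendAt (N v) (IsN-N v∉Y) v))
    decompress-boundary sψ e u∈Y v∉Y = extend-boundary e (N _) (IsN-N v∉Y) u∈N _ _
      (sψ (inj₁ (_ , u∈Y)) (inj₂ (N _ , IsN-N v∉Y)) u∈N) (∈-Region v∉Y)
      where
      u∈N : _ ∈ N _
      u∈N = ∈-N u∈Y v∉Y (adj-flip e)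

    decompress-interior : ∀ {u v} (e : T (adj u v)) (u∉Y : u ∉ Y) (v∉Y : v ∉ Y) →
      T (con u v e (extendAt (N u) (IsN-N u∉Y) u) (extendAt (N v) (IsN-N v∉Y) v))
    decompress-interior {u} {v} e u∉Y v∉Y =
      subst (λ x → T (con u v e (extendAt (N u) (IsN-N u∉Y) u) x))
            (extendAt-cong Nu≡Nv (IsN-N u∉Y) (IsN-N v∉Y) v)
            (extend-solutionOn (N u) (IsN-N u∉Y) (ψ (inj₂ (N u , IsN-N u∉Y))) u v e
              (Region⊆RegionS (∈-Region u∉Y))
              (Region⊆RegionS (subst (λ S → T (Region S v)) (sym Nu≡Nv) (∈-Region v∉Y))))
      where
      Nu≡Nv : N u ≡ N v
      Nu≡Nv = N-adj u∉Y v∉Y e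

    decompress-solution : IsSolution 𝓜 IY ψ → IsSolution 𝓜 IC decompress
    decompress-solution sψ u v e with u ∈? Y | v ∈? Y
    ... | yes u∈Y | yes v∈Y = sψ (inj₁ (u , u∈Y)) (inj₁ (v , v∈Y)) e
    ... | yes u∈Y | no v∉Y  = decompress-boundary sψ e u∈Y v∉Y
    ... | no u∉Y  | yes v∈Y = con-sym v u (adj-flip e) e _ _ (decompress-boundary sψ (adj-flip e) v∈Y u∉Y)
    ... | no u∉Y  | no v∉Y  = decompress-interior e u∉Y v∉Y

    decompress-revenue : revenue 𝓜 IY ψ ≡ revenue 𝓜 IC decompress
    decompress-revenue = begin
      revenue 𝓜 IY ψ
        ≡⟨ revenue-split-compressed ψ ⟩
      ∑ (λ v → onYes (v ∈? Y) (λ p → revIY (inj₁ (v , p)) (ψ (inj₁ (v , p))))) (allFin n)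
        + ∑ (λ S → onYes (isN? S) (λ p → revIY (inj₂ (S , p)) (ψ (inj₂ (S , p))))) subsets
        ≡⟨ cong₂ _+_ (∑-cong (allFin n) vertex-term) (∑-cong subsets λ S → onYes-cong (isN? S) (region-term S)) ⟩
      ∑ (revOnY decompress) (allFin n)
        + ∑ (λ S → onYes (isN? S) (λ _ → revOn 𝓜 I (Region S) decompress)) subsets
        ≡⟨ revenue-split decompress ⟨
      revenue 𝓜 IC decompress ∎
      where
      open ≡-Reasoning
      vertex-term : ∀ v → onYes (v ∈? Y) (λ p → revIY (inj₁ (v , p)) (ψ (inj₁ (v , p)))) ≡ revOnY decompress v
      vertex-term v with v ∈? Y
      ... | yes _ = refl
      ... | no _  = refl
      region-term : ∀ S p → revIY (inj₂ (S , p)) (ψ (inj₂ (S , p))) ≡ revOn 𝓜 I (Region S) decompress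
      region-term S p = trans (extend-revenue S p (ψ (inj₂ (S , p)))) (revOn-cong (Region S) (extendAt-Region S p))

  compress-optimum : ∀ {φ} → IsOptimum 𝓜 IC φ → IsOptimum 𝓜 IY (compress φ)
  compress-optimum {φ} (sφ , φ-max) = compress-solution sφ , λ ψ sψ → begin
    revenue 𝓜 IY ψ             ≡⟨ decompress-revenue ψ ⟩
    revenue 𝓜 IC (decompress ψ) ≲⟨ φ-max (decompress ψ) (decompress-solution ψ sψ) ⟩
    revenue 𝓜 IC φ             ≲⟨ compress-revenue sφ ⟩
    revenue 𝓜 IY (compress φ)  ∎
    where open ≤-Reasoning

  optimum-revenues : ∀ {φ ψ} → IsOptimum 𝓜 IC φ → IsOptimum 𝓜 IY ψ → revenue 𝓜 IC φ ≡ revenue 𝓜 IY ψ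
  optimum-revenues {φ} {ψ} (sφ , φ-max) (sψ , ψ-max) = ≤-antisym
    (≤-trans (compress-revenue sφ) (ψ-max (compress φ) (compress-solution sφ)))
    (≤-trans (≡⇒≤ (decompress-revenue ψ)) (φ-max (decompress ψ) (decompress-solution ψ sψ)))

lemma16 : (𝓜 : OrdMonoid) {n : ℕ} (I : Instance 𝓜 n) (Y : Subset n)
  (conn? : ∀ u v → Dec (Walk 𝓜 I Y u v))
  (rev′ : (S : Subset n) → Tuple 𝓜 I Y conn? S → OrdMonoid.R 𝓜) →
  IsCompressedRev 𝓜 I Y conn? rev′ →
  (Σ[ φ ∈ _ ] IsOptimum 𝓜 (toCSP 𝓜 I) φ)
  × (Σ[ ψ ∈ _ ] IsOptimum 𝓜 (compressed 𝓜 I Y conn? rev′) ψ)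
  × (∀ φ ψ → IsOptimum 𝓜 (toCSP 𝓜 I) φ →
       IsOptimum 𝓜 (compressed 𝓜 I Y conn? rev′) ψ →
       revenue 𝓜 (toCSP 𝓜 I) φ ≡ revenue 𝓜 (compressed 𝓜 I Y conn? rev′) ψ)
lemma16 𝓜 I Y conn? rev′ rev′-max =
    (φ , φ-opt)
  , (compress φ , compress-optimum φ-opt)
  , λ _ _ → optimum-revenues
  where
  open Solutions 𝓜 I using (IC; Assignment; optimum-exists)
  open Compression 𝓜 I Y conn? rev′ rev′-max
  φ : Assignment
  φ = proj₁ optimum-exists
  φ-opt : IsOptimum 𝓜 IC φ
  φ-opt = proj₂ optimum-exists
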